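{- Let $\delta$ be a proof (in the dicograph sequent calculus, or in the series-parallel pomset sequent calculus) of a dicograph sequent $R$ over atoms, and let $\pi_\delta=(B,R)$ be the corresponding proof net, where $B=\{a_i - a_i^\perp\}$ is the set of axiom edges. Then the axioms (with their atoms) of $\pi_\delta$ can be partitioned into two classes $\Pi_1=(a_i - a_i^\perp)_{i\in I_1}$ and $\Pi_2=(a_i - a_i^\perp)_{i\in I_2}$ such that either: (1) the only connections in $R$ between $\Pi_1$ and $\Pi_2$ are arcs from $\Pi_1$ to $\Pi_2$; or (2) the only edges between $\Pi_1$ and $\Pi_2$ come from a symmetric series composition: writing $R_1=R\restriction_{\Pi_1}$ and $R_2=R\restriction_{\Pi_2}$, one has $R_1=A_1\,\widehat{⅋}\,T_1$, $R_2=A_2\,\widehat{⅋}\,T_2$ and $R=(A_1\,\widehat{\otimes}\,A_2)\,\widehat{⅋}\,T_1\,\widehat{⅋}\,T_2$.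
   Context: Sequents are dicographs of atoms: irreflexive relations built from singletons by symmetric series composition $R_1\,\widehat{\otimes}\,R_2=R_1\uplus R_2\uplus(E_1\times E_2)\uplus(E_2\times E_1)$, directed series composition $R_1\,\widehat{<}\,R_2=R_1\uplus R_2\uplus(E_1\times E_2)$, and parallel composition $R_1\,\widehat{⅋}\,R_2=R_1\uplus R_2$ (⅋ is the par symbol). The dicograph sequent calculus has rules: axiom $\vdash a\,\widehat{⅋}\,a^\perp$; dimix from $\vdash\Gamma$ and $\vdash\Delta$ derive $\vdash\Gamma\,\widehat{<}\,\Delta$; entropy from $\vdash O[\Gamma_1,\dots,\Gamma_p]$ derive $\vdash O'[\Gamma_1,\dots,\Gamma_p]$ for series-parallel orders $O'\subset O$; tensor (or cut when $A=B^\perp$) from $\vdash A\,\widehat{⅋}\,\Gamma$ and $\vdash B\,\widehat{⅋}\,\Delta$ derive $\vdash\Gamma\,\widehat{⅋}\,(A\,\widehat{\otimes}\,B)\,\widehat{⅋}\,\Delta$; and the rules internalising $A\,\widehat{⅋}\,B$, $A\,\widehat{<}\,B$, $A\,\widehat{\otimes}\,B$ (with $A,B$ equivalent points in the context) into formulas $A⅋B$, $A<B$, $A\otimes B$. The proof net of a proof is $(B,R)$ with $R$ the conclusion dicograph of atoms and $B$ the axiom edges linking the two dual atoms introduced by the same axiom. -}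

module Defs where

open import Data.Nat using (ℕ; zero; suc; _+_)
open import Data.Bool using (Bool; true; false; not; _∧_)
open import Data.Product using (_×_; _,_; Σ; ∃; ∃-syntax)
open import Data.Sum using (_⊎_; inj₁; inj₂)
open import Data.Fin using (Fin; zero; suc; splitAt; _↑ˡ_; _↑ʳ_)
open import Data.Fin.Permutation using (Permutation; _⟨$⟩ʳ_; _⟨$⟩ˡ_)
open import Relation.Binary.PropositionalEquality using (_≡_; _≢_)

Atom : Set
Atom = ℕ × Bool

_⊥ᵃ : Atom → Atom
(x , b) ⊥ᵃ = (x , not b)

-- Irreflexive-in-intent relations on n points, given as Bool matrices:
-- R i j ≡ true means there is an arc i → j.

Rel₂ : ℕ → Set
Rel₂ n = Fin n → Fin n → Bool

data Op : Set where
  parOp serOp symOp : Op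

lr : Op → Bool
lr parOp = false
lr serOp = true
lr symOp = true

rl : Op → Bool
rl parOp = false
rl serOp = false
rl symOp = true

compose : ∀ {m n} → Op → Rel₂ m → Rel₂ n → Rel₂ (m + n)
compose {m} o R S i j with splitAt m i | splitAt m j
... | inj₁ x | inj₁ y = R x y
... | inj₂ x | inj₂ y = S x y
... | inj₁ _ | inj₂ _ = lr o
... | inj₂ _ | inj₁ _ = rl o

join : ∀ {m n} {A : Set} → (Fin m → A) → (Fin n → A) → Fin (m + n) → A
join {m} f g i with splitAt m i
... | inj₁ x = f x
... | inj₂ y = g y

empty₂ : ∀ {n} → Rel₂ n
empty₂ _ _ = false

transportRel : ∀ {m n} → Permutation m n → Rel₂ m → Rel₂ n
transportRel σ R i j = R (σ ⟨$⟩ˡ i) (σ ⟨$⟩ˡ j)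

data SPOrder : (p : ℕ) → Rel₂ p → Set where
  sp-one : SPOrder 1 empty₂
  sp-par : ∀ {m n R S} → SPOrder m R → SPOrder n S → SPOrder (m + n) (compose parOp R S)
  sp-ser : ∀ {m n R S} → SPOrder m R → SPOrder n S → SPOrder (m + n) (compose serOp R S)
  sp-iso : ∀ {m n R} (σ : Permutation m n) → SPOrder m R → SPOrder n (transportRel σ R)

record Seq : Set where
  constructor mkSeq
  field
    size : ℕ
    lab  : Fin size → Atom
    rel  : Rel₂ size
open Seq public

-- Axiom-link structures: each point is sent to the dual point of its axiom.
Links : Seq → Set
Links S = Fin (size S) → Fin (size S)

joinLinks : ∀ {m n} → (Fin m → Fin m) → (Fin n → Fin n) → Fin (m + n) → Fin (m + n)
joinLinks {m} {n} l₁ l₂ = join (λ x → l₁ x ↑ˡ n) (λ y → m ↑ʳ l₂ y)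

axSeq : Atom → Seq
axSeq a = mkSeq 2 lab' empty₂
  where
  lab' : Fin 2 → Atom
  lab' zero = a
  lab' (suc _) = a ⊥ᵃ

axLinks : Fin 2 → Fin 2
axLinks zero = suc zero
axLinks (suc _) = zero

serSeq : Seq → Seq → Seq
serSeq S T = mkSeq (size S + size T) (join (lab S) (lab T)) (compose serOp (rel S) (rel T))

-- Point 0 is isolated: the sequent has the shape  A ⅋̂ Γ  with A the point 0.
IsolatedZero : ∀ {n} → Rel₂ (suc n) → Set
IsolatedZero {n} R = (j : Fin (suc n)) → (R zero j ≡ false) × (R j zero ≡ false)

isZero : ∀ {n} → Fin n → Bool
isZero zero = true
isZero (suc _) = false

-- Given premises  A ⅋̂ Γ  (size 1+g, A = point 0) and  B ⅋̂ Δ  (size 1+d,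
-- B = point 0), the tensor conclusion  Γ ⅋̂ (A ⊗̂ B) ⅋̂ Δ, presented on the
-- disjoint union of the premises' points: the two blocks are in parallel,
-- except for the symmetric edge between A and B.
tensorRel : ∀ {m n} → Rel₂ m → Rel₂ n → Rel₂ (m + n)
tensorRel {m} R S i j with splitAt m i | splitAt m j
... | inj₁ x | inj₁ y = R x y
... | inj₂ x | inj₂ y = S x y
... | inj₁ x | inj₂ y = isZero x ∧ isZero y
... | inj₂ x | inj₁ y = isZero x ∧ isZero y

tensorSeq : Seq → Seq → Seq
tensorSeq S T = mkSeq (size S + size T) (join (lab S) (lab T)) (tensorRel (rel S) (rel T))

transportSeq : ∀ {n} (S : Seq) → Permutation (size S) n → Seq
transportSeq {n} S σ = mkSeq n (λ i → lab S (σ ⟨$⟩ˡ i)) (transportRel σ (rel S))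

transportLinks : ∀ {n} (S : Seq) (σ : Permutation (size S) n) → Links S → Fin n → Fin n
transportLinks S σ l i = σ ⟨$⟩ʳ l (σ ⟨$⟩ˡ i)

-- Entropy: S = O[Γ₁,…,Γₚ] and S' = O'[Γ₁,…,Γₚ] for series-parallel
-- orders O' ⊆ O on p points (same points and labels, new relation R');
-- f sends each point to the index k of the Γₖ containing it.
Entropy : (S : Seq) → Rel₂ (size S) → Set
Entropy S R' =
  Σ ℕ λ p → Σ (Fin (size S) → Fin p) λ f → Σ (Rel₂ p) λ O → Σ (Rel₂ p) λ O' →
     SPOrder p O × SPOrder p O' ×
     (∀ x y → O' x y ≡ true → O x y ≡ true) ×
     (∀ i j → f i ≢ f j → rel S i j ≡ O (f i) (f j)) ×
     (∀ i j → f i ≢ f j → R' i j ≡ O' (f i) (f j)) ×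
     (∀ i j → f i ≡ f j → R' i j ≡ rel S i j)

-- Cut-free proofs of atomic dicograph sequents, indexed by their
-- conclusion S and by the axiom links B of their proof net (B, S).

data Proof : (S : Seq) → Links S → Set where
  ax      : (a : Atom) → Proof (axSeq a) axLinks
  dimix   : ∀ {S T l₁ l₂} → Proof S l₁ → Proof T l₂ →
            Proof (serSeq S T) (joinLinks l₁ l₂)
  entropy : ∀ {S l} (R' : Rel₂ (size S)) → Entropy S R' →
            Proof S l → Proof (mkSeq (size S) (lab S) R') l
  tensor  : ∀ {g d} {labS : Fin (suc g) → Atom} {labT : Fin (suc d) → Atom}
              {R : Rel₂ (suc g)} {Q : Rel₂ (suc d)} {l₁ l₂} →
            Proof (mkSeq (suc g) labS R) l₁ → IsolatedZero R →
            Proof (mkSeq (suc d) labT Q) l₂ → IsolatedZero Q →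
            Proof (tensorSeq (mkSeq (suc g) labS R) (mkSeq (suc d) labT Q))
                  (joinLinks l₁ l₂)
  exch    : ∀ {S l n} (σ : Permutation (size S) n) → Proof S l →
            Proof (transportSeq S σ) (transportLinks S σ l)

-- A partition of the axioms
-- (with their atoms) of a net (l, S) into two classes is a colouring
-- c of the points constant on axioms; Π₁ = {c ≡ true}, Π₂ = {c ≡ false}.

IsAxiomPartition : (S : Seq) → Links S → (Fin (size S) → Bool) → Set
IsAxiomPartition S l c =
  (∀ i → c (l i) ≡ c i) ×
  (∃[ i ] c i ≡ true) × (∃[ j ] c j ≡ false)

Case1 : (S : Seq) → (Fin (size S) → Bool) → Set
Case1 S c = ∀ i j → c i ≡ true → c j ≡ false → rel S j i ≡ false

-- (2) R₁ = A₁ ⅋̂ T₁, R₂ = A₂ ⅋̂ T₂ and R = (A₁ ⊗̂ A₂) ⅋̂ T₁ ⅋̂ T₂,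
-- with a marking the points of A₁ ∪ A₂ (all four parts nonempty dicographs).
Case2 : (S : Seq) → (Fin (size S) → Bool) → Set
Case2 S c = Σ (Fin (size S) → Bool) λ a →
  (∀ i j → c i ≡ true → c j ≡ false →
     (rel S i j ≡ (a i ∧ a j)) × (rel S j i ≡ (a i ∧ a j))) ×
  (∀ i j → c i ≡ c j → a i ≢ a j → rel S i j ≡ false) ×
  (∃[ i ] (c i ≡ true × a i ≡ true)) × (∃[ i ] (c i ≡ true × a i ≡ false)) ×
  (∃[ i ] (c i ≡ false × a i ≡ true)) × (∃[ i ] (c i ≡ false × a i ≡ false))

{-# OPTIONS --safe #-}
-- Only the axiom rule concludes with fewer than three points, so a larger
-- proof ends with dimix, tensor, entropy or exchange.  Colouring the points by
-- the premise they come from, dimix gives case (1) and tensor gives case (2),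
-- with A₁, A₂ the two tensored formulas.  Exchange merely relabels.  Entropy
-- removes arcs but never an edge (a pair of opposite arcs): inside a block Γₖ
-- nothing changes, and an edge across two blocks would be an edge of the
-- series-parallel order O, which is asymmetric.  Both cases survive this.
module Submission where

open import Defs
open import Data.Nat using (ℕ; suc; _+_; _≤_; z≤n; s≤s; s≤s⁻¹)
open import Data.Nat.Properties using (≤-trans; m≤m+n; n≤1+n)
open import Data.Bool using (Bool; true; false; _∧_)
open import Data.Bool.Properties using (∧-comm)
open import Data.Fin using (Fin; zero; suc; splitAt; _↑ˡ_; _↑ʳ_; _≟_; fromℕ<)
open import Data.Fin.Properties using (splitAt-↑ˡ; splitAt-↑ʳ; splitAt⁻¹-↑ˡ; splitAt⁻¹-↑ʳ)
open import Data.Fin.Permutation using (Permutation; _⟨$⟩ʳ_; _⟨$⟩ˡ_; inverseˡ; ↔⇒≡)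
open import Data.Product using (Σ; _×_; _,_; proj₁; proj₂; ∃)
open import Data.Sum using (_⊎_; inj₁; inj₂) renaming (map to ⊎-map)
open import Function using (_∘_; const)
open import Relation.Nullary using (yes; no; contradiction)
open import Relation.Binary.PropositionalEquality

data SplitAtView (m n : ℕ) : Fin (m + n) → Set where
  left  : (x : Fin m) → SplitAtView m n (x ↑ˡ n)
  right : (y : Fin n) → SplitAtView m n (m ↑ʳ y)

splitAtView : ∀ m n (i : Fin (m + n)) → SplitAtView m n i
splitAtView m n i with splitAt m i in eq
... | inj₁ x = subst (SplitAtView m n) (splitAt⁻¹-↑ˡ eq) (left x)
... | inj₂ y = subst (SplitAtView m n) (splitAt⁻¹-↑ʳ eq) (right y)

module _ {m n : ℕ} where

  join-↑ˡ : ∀ {A : Set} (f : Fin m → A) (g : Fin n → A) x → join f g (x ↑ˡ n) ≡ f x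
  join-↑ˡ f g x rewrite splitAt-↑ˡ m x n = refl

  join-↑ʳ : ∀ {A : Set} (f : Fin m → A) (g : Fin n → A) y → join f g (m ↑ʳ y) ≡ g y
  join-↑ʳ f g y rewrite splitAt-↑ʳ m n y = refl

  compose-↑ˡ-↑ˡ : ∀ o R S x y → compose {m} {n} o R S (x ↑ˡ n) (y ↑ˡ n) ≡ R x y
  compose-↑ˡ-↑ˡ o R S x y rewrite splitAt-↑ˡ m x n | splitAt-↑ˡ m y n = refl

  compose-↑ʳ-↑ʳ : ∀ o R S x y → compose {m} {n} o R S (m ↑ʳ x) (m ↑ʳ y) ≡ S x y
  compose-↑ʳ-↑ʳ o R S x y rewrite splitAt-↑ʳ m n x | splitAt-↑ʳ m n y = refl

  compose-↑ʳ-↑ˡ : ∀ o R S x y → compose {m} {n} o R S (m ↑ʳ x) (y ↑ˡ n) ≡ rl o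
  compose-↑ʳ-↑ˡ o R S x y rewrite splitAt-↑ʳ m n x | splitAt-↑ˡ m y n = refl

  tensorRel-↑ˡ-↑ˡ : ∀ R S x y → tensorRel {m} {n} R S (x ↑ˡ n) (y ↑ˡ n) ≡ R x y
  tensorRel-↑ˡ-↑ˡ R S x y rewrite splitAt-↑ˡ m x n | splitAt-↑ˡ m y n = refl

  tensorRel-↑ʳ-↑ʳ : ∀ R S x y → tensorRel {m} {n} R S (m ↑ʳ x) (m ↑ʳ y) ≡ S x y
  tensorRel-↑ʳ-↑ʳ R S x y rewrite splitAt-↑ʳ m n x | splitAt-↑ʳ m n y = refl

  tensorRel-↑ˡ-↑ʳ : ∀ R S x y → tensorRel {m} {n} R S (x ↑ˡ n) (m ↑ʳ y) ≡ isZero x ∧ isZero y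
  tensorRel-↑ˡ-↑ʳ R S x y rewrite splitAt-↑ˡ m x n | splitAt-↑ʳ m n y = refl

  tensorRel-↑ʳ-↑ˡ : ∀ R S x y → tensorRel {m} {n} R S (m ↑ʳ x) (y ↑ˡ n) ≡ isZero x ∧ isZero y
  tensorRel-↑ʳ-↑ˡ R S x y rewrite splitAt-↑ʳ m n x | splitAt-↑ˡ m y n = refl

module BlockColouring {m n : ℕ} where

  isLeft : Fin (m + n) → Bool
  isLeft = join {m} {n} (const true) (const false)

  isLeft-↑ˡ : ∀ x → isLeft (x ↑ˡ n) ≡ true
  isLeft-↑ˡ = join-↑ˡ {m} {n} (const true) (const false)

  isLeft-↑ʳ : ∀ y → isLeft (m ↑ʳ y) ≡ false
  isLeft-↑ʳ = join-↑ʳ {m} {n} (const true) (const false)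

  isLeft-joinLinks : (l₁ : Fin m → Fin m) (l₂ : Fin n → Fin n) →
                     ∀ i → isLeft (joinLinks l₁ l₂ i) ≡ isLeft i
  isLeft-joinLinks l₁ l₂ i with splitAtView m n i
  ... | left x  rewrite join-↑ˡ (λ x → l₁ x ↑ˡ n) (λ y → m ↑ʳ l₂ y) x
                      | isLeft-↑ˡ (l₁ x) | isLeft-↑ˡ x = refl
  ... | right y rewrite join-↑ʳ (λ x → l₁ x ↑ˡ n) (λ y → m ↑ʳ l₂ y) y
                      | isLeft-↑ʳ (l₂ y) | isLeft-↑ʳ y = refl

Asymmetric₂ : ∀ {n} → Rel₂ n → Set
Asymmetric₂ R = ∀ x y → R x y ≡ true → R y x ≡ false

compose-asymmetric : ∀ {m n o} {R : Rel₂ m} {S : Rel₂ n} → rl o ≡ false →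
                     Asymmetric₂ R → Asymmetric₂ S → Asymmetric₂ (compose o R S)
compose-asymmetric {m} {n} {o} {R} {S} rl≡false asymR asymS i j h
  with splitAtView m n i | splitAtView m n j
... | left x  | left y  rewrite compose-↑ˡ-↑ˡ o R S x y | compose-↑ˡ-↑ˡ o R S y x = asymR x y h
... | right x | right y rewrite compose-↑ʳ-↑ʳ o R S x y | compose-↑ʳ-↑ʳ o R S y x = asymS x y h
... | left x  | right y rewrite compose-↑ʳ-↑ˡ o R S y x = rl≡false
... | right x | left y  rewrite compose-↑ʳ-↑ˡ o R S x y = contradiction (trans (sym h) rl≡false) λ ()

SPOrder-asymmetric : ∀ {p O} → SPOrder p O → Asymmetric₂ O
SPOrder-asymmetric sp-one x y ()
SPOrder-asymmetric (sp-par O₁ O₂) =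
  compose-asymmetric refl (SPOrder-asymmetric O₁) (SPOrder-asymmetric O₂)
SPOrder-asymmetric (sp-ser O₁ O₂) =
  compose-asymmetric refl (SPOrder-asymmetric O₁) (SPOrder-asymmetric O₂)
SPOrder-asymmetric (sp-iso σ O) x y = SPOrder-asymmetric O (σ ⟨$⟩ˡ x) (σ ⟨$⟩ˡ y)

record ArcRemoval {n} (R R' : Rel₂ n) : Set where
  field
    subrelation : ∀ i j → R' i j ≡ true → R i j ≡ true
    keeps-edges : ∀ i j → R i j ≡ true → R j i ≡ true → R' i j ≡ true

module _ {n} {R R' : Rel₂ n} (removal : ArcRemoval R R') where
  open ArcRemoval removal

  arcRemoval-false : ∀ i j → R i j ≡ false → R' i j ≡ false
  arcRemoval-false i j Rij≡false with R' i j in R'ij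
  ... | false = refl
  ... | true  = trans (sym (subrelation i j R'ij)) Rij≡false

  arcRemoval-symmetric : ∀ i j b → R i j ≡ b → R j i ≡ b → R' i j ≡ b
  arcRemoval-symmetric i j false Rij _ = arcRemoval-false i j Rij
  arcRemoval-symmetric i j true  Rij Rji = keeps-edges i j Rij Rji

entropy-arcRemoval : ∀ {S R'} → Entropy S R' → ArcRemoval (rel S) R'
entropy-arcRemoval {S} {R'} (_ , f , O , O' , spO , _ , O'⊆O , S≡O , R'≡O' , R'≡S) = record
  { subrelation = subrelation
  ; keeps-edges = keeps-edges
  }
  where
  subrelation : ∀ i j → R' i j ≡ true → rel S i j ≡ true
  subrelation i j R'ij with f i ≟ f j
  ... | yes fi≡fj = trans (sym (R'≡S i j fi≡fj)) R'ij
  ... | no  fi≢fj = trans (S≡O i j fi≢fj) (O'⊆O _ _ (trans (sym (R'≡O' i j fi≢fj)) R'ij))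

  keeps-edges : ∀ i j → rel S i j ≡ true → rel S j i ≡ true → R' i j ≡ true
  keeps-edges i j Sij Sji with f i ≟ f j
  ... | yes fi≡fj = trans (R'≡S i j fi≡fj) Sij
  ... | no  fi≢fj = contradiction (trans (sym O-back) (SPOrder-asymmetric spO _ _ O-forth)) λ ()
    where
    O-forth : O (f i) (f j) ≡ true
    O-forth = trans (sym (S≡O i j fi≢fj)) Sij
    O-back : O (f j) (f i) ≡ true
    O-back = trans (sym (S≡O j i (fi≢fj ∘ sym))) Sji

Splitting : (S : Seq) → Links S → Set
Splitting S l = Σ (Fin (size S) → Bool) λ c → IsAxiomPartition S l c × (Case1 S c ⊎ Case2 S c)

module _ {S : Seq} {R' : Rel₂ (size S)} (removal : ArcRemoval (rel S) R') where
  private S' = mkSeq (size S) (lab S) R'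

  case1-arcRemoval : ∀ {c} → Case1 S c → Case1 S' c
  case1-arcRemoval case1 i j ci cj = arcRemoval-false removal j i (case1 i j ci cj)

  case2-arcRemoval : ∀ {c} → Case2 S c → Case2 S' c
  case2-arcRemoval (a , across , within , witnesses) =
    a , (λ i j ci cj → let (Sij , Sji) = across i j ci cj in
                       arcRemoval-symmetric removal i j _ Sij Sji ,
                       arcRemoval-symmetric removal j i _ Sji Sij) ,
        (λ i j cij aij → arcRemoval-false removal i j (within i j cij aij)) ,
        witnesses

  splitting-arcRemoval : ∀ {l} → Splitting S l → Splitting S' l
  splitting-arcRemoval (c , partition , cases) =
    c , partition , ⊎-map case1-arcRemoval case2-arcRemoval cases

module _ {S : Seq} {n} (σ : Permutation (size S) n) where
  private
    S' = transportSeq S σ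

    pull : ∀ {a} {A : Set a} → (Fin (size S) → A) → Fin n → A
    pull f = f ∘ (σ ⟨$⟩ˡ_)

  ∃-transport : ∀ {P : Fin (size S) → Set} → ∃ P → ∃ (pull P)
  ∃-transport {P} (i , Pi) = σ ⟨$⟩ʳ i , subst P (sym (inverseˡ σ)) Pi

  isAxiomPartition-transport : ∀ {l c} → IsAxiomPartition S l c →
                               IsAxiomPartition S' (transportLinks S σ l) (pull c)
  isAxiomPartition-transport {c = c} (c∘l≡c , true-point , false-point) =
    (λ k → trans (cong c (inverseˡ σ)) (c∘l≡c (σ ⟨$⟩ˡ k))) ,
    ∃-transport true-point , ∃-transport false-point

  case1-transport : ∀ {c} → Case1 S c → Case1 S' (pull c)
  case1-transport case1 i j = case1 (σ ⟨$⟩ˡ i) (σ ⟨$⟩ˡ j)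

  case2-transport : ∀ {c} → Case2 S c → Case2 S' (pull c)
  case2-transport (a , across , within , w₁ , w₂ , w₃ , w₄) =
    pull a ,
    (λ i j → across (σ ⟨$⟩ˡ i) (σ ⟨$⟩ˡ j)) ,
    (λ i j → within (σ ⟨$⟩ˡ i) (σ ⟨$⟩ˡ j)) ,
    ∃-transport w₁ , ∃-transport w₂ , ∃-transport w₃ , ∃-transport w₄

  splitting-transport : ∀ {l} → Splitting S l → Splitting S' (transportLinks S σ l)
  splitting-transport (c , partition , cases) =
    pull c , isAxiomPartition-transport partition ,
    ⊎-map case1-transport case2-transport cases

dimix-splitting : ∀ {S T} (l₁ : Links S) (l₂ : Links T) → Fin (size S) → Fin (size T) →
                  Splitting (serSeq S T) (joinLinks l₁ l₂)
dimix-splitting {S} {T} l₁ l₂ x y =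
  isLeft , (isLeft-joinLinks l₁ l₂ , (x ↑ˡ n , isLeft-↑ˡ x) , (m ↑ʳ y , isLeft-↑ʳ y)) , inj₁ case1
  where
  m = size S
  n = size T
  open BlockColouring {m} {n}
  case1 : Case1 (serSeq S T) isLeft
  case1 i j ci cj with splitAtView m n i | splitAtView m n j
  ... | left x  | right y = compose-↑ʳ-↑ˡ serOp (rel S) (rel T) y x
  ... | left x  | left y  = contradiction (trans (sym (isLeft-↑ˡ y)) cj) λ ()
  ... | right x | _       = contradiction (trans (sym (isLeft-↑ʳ x)) ci) λ ()

isolatedZero-apart : ∀ {k} {R : Rel₂ (suc k)} → IsolatedZero R →
                     ∀ x y → isZero x ≢ isZero y → R x y ≡ false
isolatedZero-apart iso zero    zero    ne = contradiction refl ne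
isolatedZero-apart iso zero    (suc y) _  = proj₁ (iso (suc y))
isolatedZero-apart iso (suc x) zero    _  = proj₂ (iso (suc x))
isolatedZero-apart iso (suc x) (suc y) ne = contradiction refl ne

-- The points of Γ and Δ (Fin g, Fin d) are needed for T₁ and T₂ to be nonempty.
tensor-splitting : ∀ {g d} {labS : Fin (suc g) → Atom} {labT : Fin (suc d) → Atom}
                   {R : Rel₂ (suc g)} {Q : Rel₂ (suc d)} (l₁ : Fin (suc g) → Fin (suc g))
                   (l₂ : Fin (suc d) → Fin (suc d)) → IsolatedZero R → IsolatedZero Q →
                   Fin g → Fin d →
                   Splitting (tensorSeq (mkSeq (suc g) labS R) (mkSeq (suc d) labT Q))
                             (joinLinks l₁ l₂)
tensor-splitting {g} {d} {R = R} {Q} l₁ l₂ isoR isoQ x y =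
  isLeft , (isLeft-joinLinks l₁ l₂ , (zero ↑ˡ n , isLeft-↑ˡ zero) , (m ↑ʳ zero , isLeft-↑ʳ zero)) ,
  inj₂ (a , across , within ,
        (zero ↑ˡ n  , isLeft-↑ˡ zero    , a-↑ˡ zero) , (suc x ↑ˡ n , isLeft-↑ˡ (suc x) , a-↑ˡ (suc x)) ,
        (m ↑ʳ zero  , isLeft-↑ʳ zero    , a-↑ʳ zero) , (m ↑ʳ suc y , isLeft-↑ʳ (suc y) , a-↑ʳ (suc y)))
  where
  m = suc g
  n = suc d
  open BlockColouring {m} {n}
  a : Fin (m + n) → Bool
  a = join {m} {n} isZero isZero
  a-↑ˡ : ∀ x → a (x ↑ˡ n) ≡ isZero x
  a-↑ˡ = join-↑ˡ isZero isZero
  a-↑ʳ : ∀ y → a (m ↑ʳ y) ≡ isZero y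
  a-↑ʳ = join-↑ʳ {m} {n} isZero isZero

  across : ∀ i j → isLeft i ≡ true → isLeft j ≡ false →
           (tensorRel R Q i j ≡ (a i ∧ a j)) × (tensorRel R Q j i ≡ (a i ∧ a j))
  across i j ci cj with splitAtView m n i | splitAtView m n j
  ... | left x  | right y rewrite a-↑ˡ x | a-↑ʳ y =
    tensorRel-↑ˡ-↑ʳ R Q x y , trans (tensorRel-↑ʳ-↑ˡ R Q y x) (∧-comm (isZero y) (isZero x))
  ... | left x  | left y  = contradiction (trans (sym (isLeft-↑ˡ y)) cj) λ ()
  ... | right x | _       = contradiction (trans (sym (isLeft-↑ʳ x)) ci) λ ()

  within : ∀ i j → isLeft i ≡ isLeft j → a i ≢ a j → tensorRel R Q i j ≡ false
  within i j cij aij with splitAtView m n i | splitAtView m n j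
  ... | left x  | left y  rewrite a-↑ˡ x | a-↑ˡ y =
    trans (tensorRel-↑ˡ-↑ˡ R Q x y) (isolatedZero-apart {R = R} isoR x y aij)
  ... | right x | right y rewrite a-↑ʳ x | a-↑ʳ y =
    trans (tensorRel-↑ʳ-↑ʳ R Q x y) (isolatedZero-apart {R = Q} isoQ x y aij)
  ... | left x  | right y rewrite isLeft-↑ˡ x | isLeft-↑ʳ y = contradiction cij λ ()
  ... | right x | left y  rewrite isLeft-↑ʳ x | isLeft-↑ˡ y = contradiction cij λ ()

size≥2 : ∀ {S l} → Proof S l → 2 ≤ size S
size≥2 (ax _)           = s≤s (s≤s z≤n)
size≥2 (dimix p _)      = ≤-trans (size≥2 p) (m≤m+n _ _)
size≥2 (entropy _ _ p)  = size≥2 p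
size≥2 (tensor p _ _ _) = ≤-trans (size≥2 p) (m≤m+n _ _)
size≥2 (exch σ p)       = subst (2 ≤_) (↔⇒≡ σ) (size≥2 p)

splitting : ∀ {S l} → Proof S l → 3 ≤ size S → Splitting S l
splitting (ax _) (s≤s (s≤s ()))
splitting (dimix {S} {T} {l₁} {l₂} p q) _ =
  dimix-splitting {S} {T} l₁ l₂ (fromℕ< (size≥2 p)) (fromℕ< (size≥2 q))
splitting (entropy {S} R' e p) 3≤S =
  splitting-arcRemoval {S} {R'} (entropy-arcRemoval {S} e) (splitting p 3≤S)
splitting (tensor {labS = labS} {labT} {R} {Q} {l₁} {l₂} p isoR q isoQ) _ =
  tensor-splitting {labS = labS} {labT} {R} {Q} l₁ l₂ isoR isoQ
                   (fromℕ< (s≤s⁻¹ (size≥2 p))) (fromℕ< (s≤s⁻¹ (size≥2 q)))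
splitting (exch {S} σ p) 3≤S =
  splitting-transport {S} σ (splitting p (subst (3 ≤_) (sym (↔⇒≡ σ)) 3≤S))

mainTheorem3 : ∀ {S : Seq} {l : Links S} → Proof S l → 4 ≤ size S →
    Σ (Fin (size S) → Bool) λ c → IsAxiomPartition S l c × (Case1 S c ⊎ Case2 S c)
mainTheorem3 p 4≤S = splitting p (≤-trans (n≤1+n 3) 4≤S)
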